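{- Every binary linear code of length $n\le 16$, dimension $4$ and minimum Hamming distance $7$ contains a codeword of Hamming weight $8$.
   Context: A binary linear code of length $n$ and dimension $k$ is a $k$-dimensional subspace of $\mathbb{F}_2^n$; its minimum Hamming distance is the minimum Hamming weight of a nonzero codeword. -}

module Defs where

open import Data.Bool using (Bool; true; false; _xor_; _∧_)
open import Data.Nat using (ℕ; zero; suc; _≤_)
open import Data.Vec using (Vec; []; _∷_; replicate; zipWith; map; count)
open import Data.Product using (Σ; _×_; ∃; _,_)
open import Relation.Binary.PropositionalEquality using (_≡_)
open import Relation.Nullary using (¬_)
open import Function.Bundles using (_⇔_)
open import Data.Bool.Properties using (T?)

-- The vector space F₂ⁿ, with F₂ represented by Bool (false = 0, true = 1).
F₂^ : ℕ → Set
F₂^ n = Vec Bool n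

zeroVec : ∀ {n} → F₂^ n
zeroVec = replicate _ false

_⊕_ : ∀ {n} → F₂^ n → F₂^ n → F₂^ n
_⊕_ = zipWith _xor_

_·_ : ∀ {n} → Bool → F₂^ n → F₂^ n
a · v = map (a ∧_) v

lincomb : ∀ {n k} → Vec Bool k → Vec (F₂^ n) k → F₂^ n
lincomb []       []       = zeroVec
lincomb (c ∷ cs) (g ∷ gs) = (c · g) ⊕ lincomb cs gs

weight : ∀ {n} → F₂^ n → ℕ
weight v = count T? v

LinIndep : ∀ {n k} → Vec (F₂^ n) k → Set
LinIndep {k = k} g = ∀ c → lincomb c g ≡ zeroVec → c ≡ replicate k false

IsLinearCode : (n k : ℕ) → (F₂^ n → Set) → Set
IsLinearCode n k C =
  Σ (Vec (F₂^ n) k) λ g → LinIndep g × (∀ x → C x ⇔ ∃ λ c → lincomb c g ≡ x)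

-- C has minimum distance d: the minimum weight of a nonzero codeword is d.
MinDistance : ∀ {n} → (F₂^ n → Set) → ℕ → Set
MinDistance {n} C d =
  (∀ x → C x → ¬ (x ≡ zeroVec) → d ≤ weight x)
  × (∃ λ x → C x × ¬ (x ≡ zeroVec) × weight x ≡ d)

module Submission where

-- Let G = (g₁, …, g₄) be a basis of C and p ∈ F₂⁴ the vector of parities
-- of the gᵢ.  Weight parity is additive over F₂, so the parity of the
-- codeword cG is the inner product c · p.  Hence c ↦ cG maps the kernel
-- of c ↦ c · p, which contains three independent vectors c₁, c₂, c₃, onto
-- even-weight codewords; the seven nonzero elements of span{c₁, c₂, c₃}
-- give seven nonzero even codewords.  Each has weight ≥ 7, so if none has
-- weight 8 they all have weight ≥ 10, a total of at least 70.  On the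
-- other hand the seven nonzero vectors of the span of any three vectors
-- u, v, w have, in every coordinate, at most four entries equal to 1, so
-- their total weight is at most 4n ≤ 64.

open import Defs
open import Data.Nat using (ℕ; _≤_)
open import Data.Product using (∃; _×_)
open import Relation.Binary.PropositionalEquality using (_≡_)

open import Algebra.Bundles using (CommutativeRing)
import Algebra.Properties.CommutativeSemigroup as CommutativeSemigroupProperties
open import Data.Bool using (Bool; true; false; not; _∧_; _xor_)
open import Data.Bool.Properties using (xor-∧-commutativeRing; ∧-distribʳ-xor) renaming (_≟_ to _≟ᵇ_)
open import Data.Empty using (⊥-elim)
open import Data.List using (List; []; _∷_; length) renaming (map to mapₗ)
open import Data.List.Properties using (map-∘)
open import Data.List.Relation.Unary.All using (All; []; _∷_; all?) renaming (map to mapᴬ)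
open import Data.Nat.ListAction using (sum)
open import Data.Nat using (zero; suc; _+_; _*_; z≤n; s≤s; _≤?_)
open import Data.Nat.Properties using (+-commutativeSemigroup; +-mono-≤; *-monoʳ-≤; *-suc; ≤-refl; ≤-trans; module ≤-Reasoning)
open import Data.Product using (_,_)
open import Data.Sum using (_⊎_; inj₁; inj₂; [_,_]′; map₁)
open import Function using (id; _∘_)
open import Data.Vec using (Vec; []; _∷_; map; zipWith; head; tail)
open import Data.Vec.Properties using (≡-dec)
open import Function.Bundles using (Equivalence)
open import Relation.Nullary using (¬_; Dec; ¬?)
open import Relation.Nullary.Decidable using (from-yes; from-no; map′; _×-dec_)
open import Relation.Unary using (Decidable)
open import Relation.Binary.PropositionalEquality using (refl; sym; trans; cong; cong₂; module ≡-Reasoning)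

open CommutativeSemigroupProperties (CommutativeRing.+-commutativeSemigroup xor-∧-commutativeRing)
  using () renaming (interchange to xor-interchange)
open CommutativeSemigroupProperties +-commutativeSemigroup
  using () renaming (interchange to +-interchange)

⊕-interchange : ∀ {n} (p q r s : F₂^ n) → (p ⊕ q) ⊕ (r ⊕ s) ≡ (p ⊕ r) ⊕ (q ⊕ s)
⊕-interchange []      []      []      []      = refl
⊕-interchange (a ∷ p) (b ∷ q) (c ∷ r) (d ∷ s) = cong₂ _∷_ (xor-interchange a b c d) (⊕-interchange p q r s)

zeroVec-⊕ : ∀ n → zeroVec {n} ≡ zeroVec ⊕ zeroVec
zeroVec-⊕ zero    = refl
zeroVec-⊕ (suc n) = cong (false ∷_) (zeroVec-⊕ n)

·-distrib-xor : ∀ {n} a b (v : F₂^ n) → (a xor b) · v ≡ (a · v) ⊕ (b · v)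
·-distrib-xor a b []      = refl
·-distrib-xor a b (x ∷ v) = cong₂ _∷_ (∧-distribʳ-xor x a b) (·-distrib-xor a b v)

lincomb-⊕ : ∀ {n k} (c d : Vec Bool k) (g : Vec (F₂^ n) k) →
            lincomb (c ⊕ d) g ≡ lincomb c g ⊕ lincomb d g
lincomb-⊕ {n} [] [] [] = zeroVec-⊕ n
lincomb-⊕ (a ∷ c) (b ∷ d) (h ∷ g) = begin
  ((a xor b) · h) ⊕ lincomb (c ⊕ d) g               ≡⟨ cong₂ _⊕_ (·-distrib-xor a b h) (lincomb-⊕ c d g) ⟩
  ((a · h) ⊕ (b · h)) ⊕ (lincomb c g ⊕ lincomb d g) ≡⟨ ⊕-interchange (a · h) (b · h) (lincomb c g) (lincomb d g) ⟩
  ((a · h) ⊕ lincomb c g) ⊕ ((b · h) ⊕ lincomb d g) ∎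
  where open ≡-Reasoning

isOdd : ℕ → Bool
isOdd zero    = false
isOdd (suc m) = not (isOdd m)

parity : ∀ {n} → F₂^ n → Bool
parity v = isOdd (weight v)

parity-∷ : ∀ {n} (b : Bool) (v : F₂^ n) → parity (b ∷ v) ≡ b xor parity v
parity-∷ true  v = refl
parity-∷ false v = refl

-- Parity is additive: the weight of x ⊕ y is weight x + weight y minus
-- twice the size of their common support.
parity-⊕ : ∀ {n} (x y : F₂^ n) → parity (x ⊕ y) ≡ parity x xor parity y
parity-⊕ []      []      = refl
parity-⊕ (a ∷ x) (b ∷ y) = begin
  parity ((a xor b) ∷ (x ⊕ y))             ≡⟨ parity-∷ (a xor b) (x ⊕ y) ⟩
  (a xor b) xor parity (x ⊕ y)             ≡⟨ cong ((a xor b) xor_) (parity-⊕ x y) ⟩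
  (a xor b) xor (parity x xor parity y)    ≡⟨ xor-interchange a b (parity x) (parity y) ⟩
  (a xor parity x) xor (b xor parity y)    ≡⟨ sym (cong₂ _xor_ (parity-∷ a x) (parity-∷ b y)) ⟩
  parity (a ∷ x) xor parity (b ∷ y)        ∎
  where open ≡-Reasoning

parity-zeroVec : ∀ n → parity (zeroVec {n}) ≡ false
parity-zeroVec zero    = refl
parity-zeroVec (suc n) = parity-zeroVec n

parity-· : ∀ {n} (a : Bool) (v : F₂^ n) → parity (a · v) ≡ a ∧ parity v
parity-· false []      = refl
parity-· true  []      = refl
parity-· false (x ∷ v) = parity-· false v
parity-· true  (x ∷ v) = trans (parity-∷ x (true · v)) (trans (cong (x xor_) (parity-· true v)) (sym (parity-∷ x v)))

_∙_ : ∀ {k} → Vec Bool k → Vec Bool k → Bool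
[]       ∙ []       = false
(a ∷ as) ∙ (b ∷ bs) = (a ∧ b) xor (as ∙ bs)

parity-lincomb : ∀ {n k} (c : Vec Bool k) (g : Vec (F₂^ n) k) →
                 parity (lincomb c g) ≡ c ∙ map parity g
parity-lincomb {n} []      []      = parity-zeroVec n
parity-lincomb     (a ∷ c) (h ∷ g) =
  trans (parity-⊕ (a · h) (lincomb c g)) (cong₂ _xor_ (parity-· a h) (parity-lincomb c g))

evenWeightGap : ∀ {w} → 7 ≤ w → isOdd w ≡ false → w ≡ 8 ⊎ 10 ≤ w
evenWeightGap (s≤s (s≤s (s≤s (s≤s (s≤s (s≤s (s≤s (z≤n {r})))))))) = gap r
  where
  gap : ∀ r → isOdd (7 + r) ≡ false → 7 + r ≡ 8 ⊎ 10 ≤ 7 + r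
  gap 0                   ()
  gap 1                   _  = inj₁ refl
  gap 2                   ()
  gap (suc (suc (suc r))) _  = inj₂ (s≤s (s≤s (s≤s (s≤s (s≤s (s≤s (s≤s (s≤s (s≤s (s≤s z≤n))))))))))

-- The nonzero vectors of the span of three vectors u, v, w (all seven of
-- them are nonzero exactly when u, v, w are independent).
span⁺ : ∀ {n} → Vec (F₂^ n) 3 → List (F₂^ n)
span⁺ t = u ∷ v ∷ u ⊕ v ∷ w ∷ u ⊕ w ∷ v ⊕ w ∷ (u ⊕ v) ⊕ w ∷ []
  where
  u v w : F₂^ _
  u = head t
  v = head (tail t)
  w = head (tail (tail t))

span⁺-map : ∀ {m n} (f : F₂^ m → F₂^ n) → (∀ x y → f (x ⊕ y) ≡ f x ⊕ f y) →
            (t : Vec (F₂^ m) 3) → mapₗ f (span⁺ t) ≡ span⁺ (map f t)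
span⁺-map f additive (u ∷ v ∷ w ∷ [])
  rewrite additive u v | additive u w | additive v w | additive (u ⊕ v) w | additive u v = refl

totalWeight : ∀ {n} → List (F₂^ n) → ℕ
totalWeight vs = sum (mapₗ weight vs)

firstCoordinate : ∀ {n} → F₂^ (suc n) → F₂^ 1
firstCoordinate v = head v ∷ []

weight-∷ : ∀ {n} (b : Bool) (v : F₂^ n) → weight (b ∷ v) ≡ weight (b ∷ []) + weight v
weight-∷ true  v = refl
weight-∷ false v = refl

totalWeight-split : ∀ {n} (vs : List (F₂^ (suc n))) →
  totalWeight vs ≡ totalWeight (mapₗ firstCoordinate vs) + totalWeight (mapₗ tail vs)
totalWeight-split []             = refl
totalWeight-split ((b ∷ v) ∷ vs) = begin
  weight (b ∷ v) + totalWeight vs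
    ≡⟨ cong₂ _+_ (weight-∷ b v) (totalWeight-split vs) ⟩
  (weight (b ∷ []) + weight v) + (totalWeight (mapₗ firstCoordinate vs) + totalWeight (mapₗ tail vs))
    ≡⟨ +-interchange (weight (b ∷ [])) (weight v) _ _ ⟩
  (weight (b ∷ []) + totalWeight (mapₗ firstCoordinate vs)) + (weight v + totalWeight (mapₗ tail vs)) ∎
  where open ≡-Reasoning

-- In a single coordinate, at most four of the seven vectors of span⁺ are 1:
-- a nonzero functional on F₂³ takes the value 1 at exactly four points.
span⁺-column : ∀ x y z → totalWeight (span⁺ ((x ∷ []) ∷ (y ∷ []) ∷ (z ∷ []) ∷ [])) ≤ 4
span⁺-column true  true  true  = ≤-refl
span⁺-column true  true  false = ≤-refl
span⁺-column true  false true  = ≤-refl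
span⁺-column true  false false = ≤-refl
span⁺-column false true  true  = ≤-refl
span⁺-column false true  false = ≤-refl
span⁺-column false false true  = ≤-refl
span⁺-column false false false = z≤n

span⁺-weight : ∀ n (t : Vec (F₂^ n) 3) → totalWeight (span⁺ t) ≤ 4 * n
span⁺-weight zero    ([] ∷ [] ∷ [] ∷ [])                = z≤n
span⁺-weight (suc n) ((x ∷ u) ∷ (y ∷ v) ∷ (z ∷ w) ∷ []) = begin
  totalWeight (span⁺ ((x ∷ u) ∷ (y ∷ v) ∷ (z ∷ w) ∷ []))
    ≡⟨ totalWeight-split (span⁺ ((x ∷ u) ∷ (y ∷ v) ∷ (z ∷ w) ∷ [])) ⟩
  totalWeight (span⁺ ((x ∷ []) ∷ (y ∷ []) ∷ (z ∷ []) ∷ [])) + totalWeight (span⁺ (u ∷ v ∷ w ∷ []))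
    ≤⟨ +-mono-≤ (span⁺-column x y z) (span⁺-weight n (u ∷ v ∷ w ∷ [])) ⟩
  4 + 4 * n
    ≡⟨ sym (*-suc 4 n) ⟩
  4 * suc n ∎
  where open ≤-Reasoning

sum-≥-or : ∀ {A B : Set} (f : B → ℕ) {m : ℕ} (xs : List B) →
           All (λ x → A ⊎ m ≤ f x) xs → A ⊎ length xs * m ≤ sum (mapₗ f xs)
sum-≥-or f []       []              = inj₂ z≤n
sum-≥-or f (x ∷ xs) (inj₁ a  ∷ _)   = inj₁ a
sum-≥-or f (x ∷ xs) (inj₂ hx ∷ hxs) with sum-≥-or f xs hxs
... | inj₁ a    = inj₁ a
... | inj₂ hsum = inj₂ (+-mono-≤ hx hsum)

∀? : ∀ k {P : F₂^ k → Set} → Decidable P → Dec (∀ v → P v)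
∀? zero    P? = map′ (λ { p [] → p }) (λ all → all []) (P? [])
∀? (suc k) {P} P? = map′ combine (λ all → (λ v → all (true ∷ v)) , (λ v → all (false ∷ v)))
                     (∀? k (λ v → P? (true ∷ v)) ×-dec ∀? k (λ v → P? (false ∷ v)))
  where
  combine : (∀ v → P (true ∷ v)) × (∀ v → P (false ∷ v)) → ∀ v → P v
  combine (onTrue , onFalse) (true  ∷ v) = onTrue v
  combine (onTrue , onFalse) (false ∷ v) = onFalse v

units : ∀ k → Vec (F₂^ k) k
units zero    = []
units (suc k) = (true ∷ zeroVec) ∷ map (false ∷_) (units k)

-- k independent vectors in the kernel of c ↦ c ∙ p on F₂ᵏ⁺¹, by
-- eliminating the first coordinate: for p = (1, q) take the vectors
-- (qᵢ, eᵢ); for p = (0, q) take (1, 0) together with (0, b) for each b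
-- in a kernel basis for q.
kernelBasis : ∀ {k} → F₂^ (suc k) → Vec (F₂^ (suc k)) k
kernelBasis {k}     (true  ∷ q) = zipWith _∷_ q (units k)
kernelBasis {zero}  (false ∷ q) = []
kernelBasis {suc k} (false ∷ q) = (true ∷ zeroVec) ∷ map (false ∷_) (kernelBasis q)

NonzeroOrthogonal : ∀ {k} → F₂^ k → F₂^ k → Set
NonzeroOrthogonal p c = ¬ c ≡ zeroVec × c ∙ p ≡ false

kernelBasis-span⁺ : ∀ p → All (NonzeroOrthogonal p) (span⁺ (kernelBasis {3} p))
kernelBasis-span⁺ = from-yes (∀? 4 λ p → all? (nonzeroOrthogonal? p) (span⁺ (kernelBasis p)))
  where
  nonzeroOrthogonal? : ∀ p c → Dec (NonzeroOrthogonal {4} p c)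
  nonzeroOrthogonal? p c = ¬? (≡-dec _≟ᵇ_ c zeroVec) ×-dec (c ∙ p ≟ᵇ false)

lemma1 : (n : ℕ) → n ≤ 16 → (C : F₂^ n → Set) →
    IsLinearCode n 4 C → MinDistance C 7 →
    ∃ λ x → C x × weight x ≡ 8
lemma1 n n≤16 C (g , independent , spanning) (minDistance , _) =
  [ id , (λ 70≤total → ⊥-elim (from-no (70 ≤? 64) (≤-trans 70≤total total≤64))) ]′
    (sum-≥-or (weight ∘ encode) {10} messages (mapᴬ eightOrHeavy (kernelBasis-span⁺ p)))
  where
  encode : F₂^ 4 → F₂^ n
  encode c = lincomb c g

  Goal : Set
  Goal = ∃ λ x → C x × weight x ≡ 8

  -- Messages orthogonal to p are exactly those with even-weight codewords.
  p : F₂^ 4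
  p = map parity g

  messages : List (F₂^ 4)
  messages = span⁺ (kernelBasis p)

  eightOrHeavy : ∀ {c} → NonzeroOrthogonal p c → Goal ⊎ 10 ≤ weight (encode c)
  eightOrHeavy {c} (c≢0 , c∙p≡0) =
    map₁ (λ w≡8 → encode c , inC , w≡8)
         (evenWeightGap (minDistance (encode c) inC (λ encoded≡0 → c≢0 (independent c encoded≡0)))
                        (trans (parity-lincomb c g) c∙p≡0))
    where
    inC : C (encode c)
    inC = Equivalence.from (spanning (encode c)) (c , refl)

  total≤64 : sum (mapₗ (weight ∘ encode) messages) ≤ 64
  total≤64 = begin
    sum (mapₗ (weight ∘ encode) messages)  ≡⟨ cong sum (map-∘ {g = weight} {f = encode} messages) ⟩
    totalWeight (mapₗ encode messages)     ≡⟨ cong totalWeight (span⁺-map encode (λ x y → lincomb-⊕ x y g) (kernelBasis p)) ⟩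
    totalWeight (span⁺ (map encode (kernelBasis p))) ≤⟨ span⁺-weight n (map encode (kernelBasis p)) ⟩
    4 * n                                  ≤⟨ *-monoʳ-≤ 4 n≤16 ⟩
    64                                     ∎
    where open ≤-Reasoning
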